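{- The following eight mesh patterns $(12,R)$ are pairwise equidistributed, where $R$ ranges over: $\{(0,2),(1,2),(2,2),(0,1),(2,1),(2,0)\}$, $\{(0,2),(1,2),(2,2),(2,1),(1,0),(2,0)\}$, $\{(0,2),(1,2),(0,1),(0,0),(1,0),(2,0)\}$, $\{(0,2),(0,1),(2,1),(0,0),(1,0),(2,0)\}$, $\{(0,2),(1,2),(2,2),(1,1),(2,1),(2,0)\}$, $\{(0,2),(0,1),(1,1),(0,0),(1,0),(2,0)\}$, $\{(0,2),(1,2),(2,2),(2,1),(0,0),(2,0)\}$, $\{(0,2),(2,2),(0,1),(0,0),(1,0),(2,0)\}$. Moreover, for each such pattern $p$, with $F(x)=\sum_{n\ge0}n!x^n$, $A(x)=\sum_{n\ge0}s_{n,0}(p)x^n$ and $F(x,q)=\sum_{n\ge0}x^n\sum_{\pi\in S_n}q^{p(\pi)}$, $$A(x)=(1-x)F(x)+x,\qquad F(x,q)=(1-x)F(x)+x+x\sum_{n\ge1}\prod_{i=0}^{n-1}(q+i)\,x^n.$$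
   Context: For $R\subseteq\{0,1,2\}^2$ and $\pi=\pi_1\cdots\pi_n\in S_n$, an occurrence of the mesh pattern $(12,R)$ in $\pi$ is a pair of positions $i_1<i_2$ with $\pi_{i_1}<\pi_{i_2}$ such that, setting $x_0=0,x_1=i_1,x_2=i_2,x_3=n+1$ and $y_0=0,y_1=\pi_{i_1},y_2=\pi_{i_2},y_3=n+1$, for every $(a,b)\in R$ there is no index $k$ with $x_a<k<x_{a+1}$ and $y_b<\pi_k<y_{b+1}$. $p(\pi)$ is the number of occurrences of $p$ in $\pi$; $s_{n,k}(p)$ the number of $\pi\in S_n$ with $p(\pi)=k$; $p_1,p_2$ are equidistributed if $s_{n,k}(p_1)=s_{n,k}(p_2)$ for all $n,k\ge 0$. Generating functions are formal power series. -}

module Defs where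

open import Data.Bool using (Bool; true; false; _∧_; _∨_; not; if_then_else_)
open import Data.Nat using (ℕ; zero; suc; _∸_; _<ᵇ_; _≡ᵇ_; _!)
open import Data.Integer using (ℤ; +_; _+_; _-_; _*_)
open import Data.Fin using (Fin; toℕ; zero; suc; inject₁)
open import Data.List using (List; []; _∷_; map; concatMap; length; filterᵇ; allFin; foldr; cartesianProduct)
open import Data.Bool.ListAction using (and; or)
open import Data.Vec using (Vec; []; _∷_; lookup)
open import Data.Product using (_×_; _,_; proj₁; proj₂)
open import Relation.Binary.PropositionalEquality using (_≡_)

-- Permutations of [n], represented as words π₁…πₙ.
-- A word is a vector of length n over Fin n; entry i (0-based) holds
-- the value π_{i+1} - 1.  S_n = words whose entries are pairwise distinct.

allWords : (m n : ℕ) → List (Vec (Fin n) m)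
allWords zero    n = [] ∷ []
allWords (suc m) n = concatMap (λ a → map (a ∷_) (allWords m n)) (allFin n)

finEq : ∀ {n} → Fin n → Fin n → Bool
finEq a b = toℕ a ≡ᵇ toℕ b

isPerm : ∀ {n} → Vec (Fin n) n → Bool
isPerm {n} w = and (map (λ i → and (map (λ j →
  finEq i j ∨ not (finEq (lookup w i) (lookup w j))) (allFin n))) (allFin n))

perms : (n : ℕ) → List (Vec (Fin n) n)
perms n = filterᵇ isPerm (allWords n n)

-- Mesh patterns (12,R), R ⊆ {0,1,2}², given as a list of boxes (a,b).

Box : Set
Box = Fin 3 × Fin 3

MeshR : Set
MeshR = List Box

-- 1-based value π_k at 1-based position toℕ i + 1
val : ∀ {n} → Vec (Fin n) n → Fin n → ℕ
val w i = suc (toℕ (lookup w i))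

btw : ℕ → ℕ → ℕ → Bool
btw lo m hi = (lo <ᵇ m) ∧ (m <ᵇ hi)

-- x₀ = 0, x₁ = i₁, x₂ = i₂, x₃ = n+1 (and similarly for y); index 0..3
coord : ℕ → ℕ → ℕ → Fin 4 → ℕ
coord c₁ c₂ top zero                   = 0
coord c₁ c₂ top (suc zero)             = c₁
coord c₁ c₂ top (suc (suc zero))       = c₂
coord c₁ c₂ top (suc (suc (suc zero))) = top

boxEmpty : ∀ {n} → Vec (Fin n) n → Fin n → Fin n → Box → Bool
boxEmpty {n} w i₁ i₂ (a , b) = not (or (map (λ k →
      btw (X (inject₁ a)) (suc (toℕ k)) (X (suc a))
    ∧ btw (Y (inject₁ b)) (val w k) (Y (suc b))) (allFin n)))
  where
  X Y : Fin 4 → ℕ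
  X = coord (suc (toℕ i₁)) (suc (toℕ i₂)) (suc n)
  Y = coord (val w i₁) (val w i₂) (suc n)

isOcc : ∀ {n} → MeshR → Vec (Fin n) n → Fin n → Fin n → Bool
isOcc R w i₁ i₂ = (toℕ i₁ <ᵇ toℕ i₂) ∧ (val w i₁ <ᵇ val w i₂)
                ∧ and (map (boxEmpty w i₁ i₂) R)

occ : ∀ {n} → MeshR → Vec (Fin n) n → ℕ
occ {n} R w = length (filterᵇ (λ ij → isOcc R w (proj₁ ij) (proj₂ ij))
                 (cartesianProduct (allFin n) (allFin n)))

s : MeshR → ℕ → ℕ → ℕ
s R n k = length (filterᵇ (λ w → occ R w ≡ᵇ k) (perms n))

Equidistributed : MeshR → MeshR → Set
Equidistributed R₁ R₂ = ∀ n k → s R₁ n k ≡ s R₂ n k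

-- Formal power series over ℤ, by coefficients.
-- Ser1 : series in one variable (x, or q for polynomials),
-- Ser2 : series in x whose coefficients are series in q
--        (f n k = coefficient of x^n q^k).

Ser1 : Set
Ser1 = ℕ → ℤ

Ser2 : Set
Ser2 = ℕ → Ser1

sumTo : ℕ → (ℕ → ℤ) → ℤ
sumTo zero    f = f 0
sumTo (suc n) f = sumTo n f + f (suc n)

0₁ : Ser1
0₁ _ = + 0

1₁ : Ser1
1₁ n = if n ≡ᵇ 0 then + 1 else + 0

var₁ : Ser1
var₁ n = if n ≡ᵇ 1 then + 1 else + 0

const₁ : ℤ → Ser1
const₁ c n = if n ≡ᵇ 0 then c else + 0

_⊕₁_ : Ser1 → Ser1 → Ser1
(f ⊕₁ g) n = f n + g n

_⊖₁_ : Ser1 → Ser1 → Ser1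
(f ⊖₁ g) n = f n - g n

_⊛₁_ : Ser1 → Ser1 → Ser1
(f ⊛₁ g) n = sumTo n (λ i → f i * g (n ∸ i))

_≈₁_ : Ser1 → Ser1 → Set
f ≈₁ g = ∀ n → f n ≡ g n

_⊕₂_ : Ser2 → Ser2 → Ser2
(f ⊕₂ g) n = f n ⊕₁ g n

_⊛₂_ : Ser2 → Ser2 → Ser2
(f ⊛₂ g) n k = sumTo n (λ i → (f i ⊛₁ g (n ∸ i)) k)

X₂ : Ser2
X₂ n = if n ≡ᵇ 1 then 1₁ else 0₁

lift : Ser1 → Ser2
lift f n = const₁ (f n)

_≈₂_ : Ser2 → Ser2 → Set
f ≈₂ g = ∀ n k → f n k ≡ g n k

sumFrom1 : (ℕ → Ser1) → Ser2
sumFrom1 a n = if n ≡ᵇ 0 then 0₁ else a n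

rising : ℕ → Ser1
rising zero    = 1₁
rising (suc n) = rising n ⊛₁ (var₁ ⊕₁ const₁ (+ n))

Fact : Ser1
Fact n = + (n !)

Agf : MeshR → Ser1
Agf R n = + (s R n 0)

mono : ℕ → Ser1
mono m k = if k ≡ᵇ m then + 1 else + 0

Fgf : MeshR → Ser2
Fgf R n = foldr (λ w acc → mono (occ R w) ⊕₁ acc) 0₁ (perms n)

f0 f1 f2 : Fin 3
f0 = zero
f1 = suc zero
f2 = suc (suc zero)

R₁ R₂ R₃ R₄ R₅ R₆ R₇ R₈ : MeshR
R₁ = (f0 , f2) ∷ (f1 , f2) ∷ (f2 , f2) ∷ (f0 , f1) ∷ (f2 , f1) ∷ (f2 , f0) ∷ []
R₂ = (f0 , f2) ∷ (f1 , f2) ∷ (f2 , f2) ∷ (f2 , f1) ∷ (f1 , f0) ∷ (f2 , f0) ∷ []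
R₃ = (f0 , f2) ∷ (f1 , f2) ∷ (f0 , f1) ∷ (f0 , f0) ∷ (f1 , f0) ∷ (f2 , f0) ∷ []
R₄ = (f0 , f2) ∷ (f0 , f1) ∷ (f2 , f1) ∷ (f0 , f0) ∷ (f1 , f0) ∷ (f2 , f0) ∷ []
R₅ = (f0 , f2) ∷ (f1 , f2) ∷ (f2 , f2) ∷ (f1 , f1) ∷ (f2 , f1) ∷ (f2 , f0) ∷ []
R₆ = (f0 , f2) ∷ (f0 , f1) ∷ (f1 , f1) ∷ (f0 , f0) ∷ (f1 , f0) ∷ (f2 , f0) ∷ []
R₇ = (f0 , f2) ∷ (f1 , f2) ∷ (f2 , f2) ∷ (f2 , f1) ∷ (f0 , f0) ∷ (f2 , f0) ∷ []
R₈ = (f0 , f2) ∷ (f2 , f2) ∷ (f0 , f1) ∷ (f0 , f0) ∷ (f1 , f0) ∷ (f2 , f0) ∷ []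

patterns : Fin 8 → MeshR
patterns zero = R₁
patterns (suc zero) = R₂
patterns (suc (suc zero)) = R₃
patterns (suc (suc (suc zero))) = R₄
patterns (suc (suc (suc (suc zero)))) = R₅
patterns (suc (suc (suc (suc (suc zero))))) = R₆
patterns (suc (suc (suc (suc (suc (suc zero)))))) = R₇
patterns (suc (suc (suc (suc (suc (suc (suc zero))))))) = R₈

{-# OPTIONS --safe --with-K #-}
-- Each of the eight sets R consists of one outer row and one outer column of boxes (top and
-- right, or bottom and left) together with a single inner box E. In the first case an occurrence
-- (i₁ , i₂) can only end at the last position with the largest value, so p(π) = 0 unless π is σ
-- followed by n, and then the occurrences are the pairs (i , n) whose box E is empty: the records
-- of σ of the kind fixed by E (left-to-right maxima for E = (0,1), and so on). The second case is
-- the same with π = 1 followed by σ shifted up. Inserting an extremal value at an extremal position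
-- shows that the permutations of [m] with k records of any one kind are counted by the Stirling
-- number c(m,k), so every pattern has s_{m+1,k} = c(m,k) + [k = 0]·m·m!; the generating functions
-- are this count rewritten, using Σ_k c(m,k) q^k = q(q+1)⋯(q+m-1).

module Submission where

open import Defs
open import Data.Fin using (Fin)
open import Data.Product using (_×_)

import Algebra.Properties.CommutativeMonoid.Sum as MonoidSum
open import Data.Bool.Base using (Bool; true; false; T; not; _∧_; _∨_)
import Data.Bool.Properties as 𝔹
open import Data.Bool.ListAction using (any; all)
open import Data.Empty using (⊥; ⊥-elim)
open import Data.Fin.Base using (zero; suc; toℕ; fromℕ; punchIn; punchOut; inject₁)
open import Data.Fin.Patterns using (0F; 1F; 2F; 3F; 4F; 5F; 6F; 7F)
import Data.Fin.Properties as Fin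
open import Data.Integer.Base as ℤ using (ℤ)
import Data.Integer.Properties as ℤₚ
open import Data.List.Base
  using ([]; _∷_; _++_; map; foldr; length; filterᵇ; tabulate; allFin; concatMap; cartesianProductWith)
open import Data.List.Properties using (map-++; map-∘; map-cong-local)
open import Data.List.Membership.Propositional using (_∈_)
open import Data.List.Membership.Propositional.Properties
  using (∈-allFin; ∈-filter⁺; ∈-filter⁻; ∈-cartesianProductWith⁺; ∈-cartesianProductWith⁻)
open import Data.List.Membership.Propositional.Properties.WithK using (unique∧set⇒bag)
open import Data.List.Relation.Binary.BagAndSetEquality using (∼bag⇒↭)
open import Data.List.Relation.Binary.Permutation.Propositional using (_↭_)
import Data.List.Relation.Binary.Permutation.Propositional.Properties as ↭
import Data.List.Relation.Unary.All as All
open import Data.List.Relation.Unary.All.Properties using (all⁺; all⁻)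
open import Data.List.Relation.Unary.Any using (here)
open import Data.List.Relation.Unary.Unique.Propositional using (Unique; []; _∷_)
import Data.List.Relation.Unary.Unique.Propositional.Properties as Unique
open import Data.Nat.Base using (ℕ; zero; suc; _+_; _*_; _∸_; _<ᵇ_; _≡ᵇ_; _≤_; _<_; z≤n; s≤s; s≤s⁻¹; _!)
import Data.Nat.Properties as ℕ
open import Data.Nat.ListAction using (sum)
open import Data.Nat.ListAction.Properties using (sum-++; sum-↭)
open import Data.Product.Base using (_,_; proj₁; proj₂; ∃)
open import Data.Product.Properties using (≡-dec)
open import Data.Sum.Base using (_⊎_; inj₁; inj₂)
open import Data.Vec.Base as Vec using (Vec; []; _∷_; lookup; insertAt)
import Data.Vec.Properties as Vec
import Data.Vec.Functional as Vector
open import Function.Base using (_∘_; id)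
open import Function.Bundles using (Equivalence; mk⇔)
open import Function.Definitions using (Injective)
open import Relation.Binary.PropositionalEquality
open import Relation.Binary.Definitions using (DecidableEquality; tri<; tri≈; tri>)
open import Relation.Nullary using (¬_; Dec; yes; no)
open import Relation.Nullary.Decidable using (map′; _×-dec_; _⊎-dec_; from-yes)

private variable
  A B C : Set
  m n : ℕ

𝟙 : Bool → ℕ
𝟙 true  = 1
𝟙 false = 0

open MonoidSum ℕ.+-0-commutativeMonoid using (sum-syntax; sum-remove; sum-cong-≗)
  renaming (sum to ∑)
open MonoidSum 𝔹.∨-commutativeMonoid using ()
  renaming (sum to ⋁; sum-remove to ⋁-remove; sum-cong-≗ to ⋁-cong; sum-replicate-zero to ⋁-false)

foldr-map-tabulate : ∀ (_∙_ : B → B → B) ε (f : A → B) (g : Fin n → A) →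
                     foldr _∙_ ε (map f (tabulate g)) ≡ Vector.foldr _∙_ ε (f ∘ g)
foldr-map-tabulate {n = zero}  _∙_ ε f g = refl
foldr-map-tabulate {n = suc n} _∙_ ε f g = cong (f (g zero) ∙_) (foldr-map-tabulate _∙_ ε f (g ∘ suc))

sum-map-allFin : ∀ (f : Fin n → ℕ) → sum (map f (allFin n)) ≡ ∑ f
sum-map-allFin f = foldr-map-tabulate _+_ 0 f id

any-allFin : ∀ (f : Fin n → Bool) → any f (allFin n) ≡ ⋁ f
any-allFin f = foldr-map-tabulate _∨_ false f id

∑-const : ∀ n c → ∑[ i < n ] c ≡ n * c
∑-const zero    c = refl
∑-const (suc n) c = cong (c +_) (∑-const n c)

⋁-witness : ∀ (f : Fin n → Bool) k → f k ≡ true → ⋁ f ≡ true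
⋁-witness {suc n} f k fk≡true = trans (⋁-remove {i = k} f) (cong (_∨ ⋁ (Vector.removeAt f k)) fk≡true)

length-filterᵇ : ∀ (p : A → Bool) xs → length (filterᵇ p xs) ≡ sum (map (𝟙 ∘ p) xs)
length-filterᵇ p []       = refl
length-filterᵇ p (x ∷ xs) with p x
... | true  = cong suc (length-filterᵇ p xs)
... | false = length-filterᵇ p xs

sum-map-↭ : ∀ (f : A → ℕ) {xs ys} → xs ↭ ys → sum (map f xs) ≡ sum (map f ys)
sum-map-↭ f xs↭ys = sum-↭ (↭.map⁺ f xs↭ys)

sum-map-cartesianProductWith : ∀ (g : C → ℕ) (f : A → B → C) xs ys →
  sum (map g (cartesianProductWith f xs ys)) ≡ sum (map (λ x → sum (map (g ∘ f x) ys)) xs)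
sum-map-cartesianProductWith g f []       ys = refl
sum-map-cartesianProductWith g f (x ∷ xs) ys = begin
  sum (map g (map (f x) ys ++ cartesianProductWith f xs ys))
    ≡⟨ cong sum (map-++ g (map (f x) ys) _) ⟩
  sum (map g (map (f x) ys) ++ map g (cartesianProductWith f xs ys))
    ≡⟨ sum-++ (map g (map (f x) ys)) _ ⟩
  sum (map g (map (f x) ys)) + sum (map g (cartesianProductWith f xs ys))
    ≡⟨ cong₂ _+_ (cong sum (sym (map-∘ ys))) (sum-map-cartesianProductWith g f xs ys) ⟩
  sum (map (g ∘ f x) ys) + sum (map (λ x → sum (map (g ∘ f x) ys)) xs) ∎
  where open ≡-Reasoning

∑-zero : ∀ {g : Fin n → ℕ} → (∀ i → g i ≡ 0) → ∑ g ≡ 0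
∑-zero {n} vanish = trans (sum-cong-≗ vanish) (trans (∑-const n 0) (ℕ.*-zeroʳ n))

∑-concentrated : ∀ (g : Fin (suc n) → ℕ) q → (∀ i → g (punchIn q i) ≡ 0) → ∑ g ≡ g q
∑-concentrated g q vanish =
  trans (sum-remove {i = q} g) (trans (cong (g q +_) (∑-zero vanish)) (ℕ.+-identityʳ (g q)))

¬T⇒≡false : ∀ {b} → ¬ T b → b ≡ false
¬T⇒≡false {false} _  = refl
¬T⇒≡false {true}  ¬t = ⊥-elim (¬t _)

𝟙-false : ∀ {b} → ¬ T b → 𝟙 b ≡ 0
𝟙-false = cong 𝟙 ∘ ¬T⇒≡false

<ᵇ-true : m < n → (m <ᵇ n) ≡ true
<ᵇ-true m<n = Equivalence.to 𝔹.T-≡ (ℕ.<⇒<ᵇ m<n)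

<ᵇ-false : n ≤ m → (m <ᵇ n) ≡ false
<ᵇ-false {n} {m} n≤m = ¬T⇒≡false (ℕ.≤⇒≯ n≤m ∘ ℕ.<ᵇ⇒< m n)

⋁-false⁻ : ∀ (f : Fin n → Bool) → T (not (⋁ f)) → ∀ k → ¬ T (f k)
⋁-false⁻ f none k t = subst T (trans (sym (⋁-witness f k (Equivalence.to 𝔹.T-≡ t))) (Equivalence.to 𝔹.T-not-≡ none)) _

all-except : ∀ (f : A → Bool) {x xs} → x ∈ xs → All.All (λ y → f y ≡ true ⊎ y ≡ x) xs → all f xs ≡ f x
all-except f {x} {xs} x∈xs others with f x in fx
... | true  = Equivalence.to 𝔹.T-≡ (all⁻ f (All.map holds others))
  where
  holds : ∀ {y} → f y ≡ true ⊎ y ≡ x → T (f y)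
  holds (inj₁ fy)   = Equivalence.from 𝔹.T-≡ fy
  holds (inj₂ refl) = Equivalence.from 𝔹.T-≡ fx
... | false = ¬T⇒≡false λ t → subst T fx (All.lookup (all⁺ f xs t) x∈xs)

all-allFin⁺ : ∀ (p : Fin n → Bool) → T (all p (allFin n)) → ∀ i → T (p i)
all-allFin⁺ p t i = All.lookup (all⁺ p (allFin _) t) (∈-allFin i)

all-allFin⁻ : ∀ (p : Fin n → Bool) → (∀ i → T (p i)) → T (all p (allFin n))
all-allFin⁻ {n} p h = all⁻ p (All.tabulate {xs = allFin n} (λ {i} _ → h i))

-- Permutations as words

Word : ℕ → Set
Word n = Vec (Fin n) n

IsPerm : Word n → Set
IsPerm w = Injective _≡_ _≡_ (lookup w)

finEq⇒≡ : ∀ {i j : Fin n} → T (finEq i j) → i ≡ j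
finEq⇒≡ t = Fin.toℕ-injective (ℕ.≡ᵇ⇒≡ _ _ t)

≡⇒finEq : ∀ {i j : Fin n} → i ≡ j → T (finEq i j)
≡⇒finEq i≡j = ℕ.≡⇒≡ᵇ _ _ (cong toℕ i≡j)

isPerm⇒IsPerm : ∀ (w : Word n) → T (isPerm w) → IsPerm w
isPerm⇒IsPerm w t {i} {j} wi≡wj with Equivalence.to 𝔹.T-∨ (all-allFin⁺ _ (all-allFin⁺ _ t i) j)
... | inj₁ i≈j   = finEq⇒≡ i≈j
... | inj₂ wi≉wj = ⊥-elim (subst T (Equivalence.to 𝔹.T-not-≡ wi≉wj) (≡⇒finEq wi≡wj))

IsPerm⇒isPerm : ∀ (w : Word n) → IsPerm w → T (isPerm w)
IsPerm⇒isPerm w w-perm =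
  all-allFin⁻ _ λ i → all-allFin⁻ _ λ j → Equivalence.from 𝔹.T-∨ (equal-or-distinct i j)
  where
  equal-or-distinct : ∀ i j → T (finEq i j) ⊎ T (not (finEq (lookup w i) (lookup w j)))
  equal-or-distinct i j with i Fin.≟ j
  ... | yes i≡j = inj₁ (≡⇒finEq i≡j)
  ... | no  i≢j = inj₂ (Equivalence.from 𝔹.T-not-≡ (¬T⇒≡false (i≢j ∘ w-perm ∘ finEq⇒≡)))

concatMap-map≡cartesianProductWith : ∀ (f : A → B → C) xs ys →
                concatMap (λ x → map (f x) ys) xs ≡ cartesianProductWith f xs ys
concatMap-map≡cartesianProductWith f []       ys = refl
concatMap-map≡cartesianProductWith f (x ∷ xs) ys = cong (map (f x) ys ++_) (concatMap-map≡cartesianProductWith f xs ys)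

∈-allWords : ∀ m n (w : Vec (Fin n) m) → w ∈ allWords m n
∈-allWords zero    n []      = here refl
∈-allWords (suc m) n (a ∷ w) = subst (a ∷ w ∈_) (sym (concatMap-map≡cartesianProductWith _∷_ (allFin n) (allWords m n)))
  (∈-cartesianProductWith⁺ _∷_ (∈-allFin a) (∈-allWords m n w))

allWords-unique : ∀ m n → Unique (allWords m n)
allWords-unique zero    n = All.[] ∷ []
allWords-unique (suc m) n = subst Unique (sym (concatMap-map≡cartesianProductWith _∷_ (allFin n) (allWords m n)))
  (Unique.cartesianProductWith⁺ _∷_ Vec.∷-injective (Unique.allFin⁺ n) (allWords-unique m n))

∈-perms⁺ : ∀ {w : Word n} → IsPerm w → w ∈ perms n
∈-perms⁺ {n} {w} w-perm = ∈-filter⁺ (𝔹.T? ∘ isPerm) (∈-allWords n n w) (IsPerm⇒isPerm w w-perm)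

∈-perms⁻ : ∀ {w : Word n} → w ∈ perms n → IsPerm w
∈-perms⁻ {n} {w} w∈perms = isPerm⇒IsPerm w (proj₂ (∈-filter⁻ (𝔹.T? ∘ isPerm) {xs = allWords n n} w∈perms))

perms-unique : ∀ n → Unique (perms n)
perms-unique n = Unique.filter⁺ (𝔹.T? ∘ isPerm) (allWords-unique n n)

IsPerm⇒surjective : ∀ {w : Word n} → IsPerm w → ∀ v → ∃ λ i → lookup w i ≡ v
IsPerm⇒surjective {suc n} {w} w-perm v with Fin.any? (λ i → lookup w i Fin.≟ v)
... | yes hit  = hit
... | no  miss
  with i , j , i<j , eq ← Fin.pigeonhole (ℕ.n<1+n n) (λ i → punchOut (λ v≡wi → miss (i , sym v≡wi)))
  = ⊥-elim (ℕ.<⇒≢ i<j (cong toℕ (w-perm (Fin.punchOut-injective {i = v} _ _ eq))))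

insert : Fin (suc m) → Fin (suc m) → Word m → Word (suc m)
insert p v σ = insertAt (Vec.map (punchIn v) σ) p v

lookup-insert : ∀ p v (σ : Word m) → lookup (insert p v σ) p ≡ v
lookup-insert p v σ = Vec.insertAt-lookup (Vec.map (punchIn v) σ) p v

lookup-insert-punchIn : ∀ p v (σ : Word m) i → lookup (insert p v σ) (punchIn p i) ≡ punchIn v (lookup σ i)
lookup-insert-punchIn p v σ i =
  trans (Vec.insertAt-punchIn (Vec.map (punchIn v) σ) p v i) (Vec.lookup-map i (punchIn v) σ)

lookup-extensionality : ∀ {xs ys : Vec A n} → (∀ i → lookup xs i ≡ lookup ys i) → xs ≡ ys
lookup-extensionality {xs = xs} {ys} eq =
  trans (sym (Vec.tabulate∘lookup xs)) (trans (Vec.tabulate-cong eq) (Vec.tabulate∘lookup ys))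

pivot-or-punchIn : ∀ (p j : Fin (suc m)) → j ≡ p ⊎ ∃ λ i → j ≡ punchIn p i
pivot-or-punchIn p j with j Fin.≟ p
... | yes j≡p = inj₁ j≡p
... | no  j≢p = inj₂ (punchOut (j≢p ∘ sym) , sym (Fin.punchIn-punchOut (j≢p ∘ sym)))

insert-injective : ∀ p {v v′} {σ σ′ : Word m} → insert p v σ ≡ insert p v′ σ′ → v ≡ v′ × σ ≡ σ′
insert-injective p {v} {v′} {σ} {σ′} eq
  with refl ← trans (sym (lookup-insert p v σ)) (trans (cong (λ w → lookup w p) eq) (lookup-insert p v′ σ′))
  = refl , lookup-extensionality λ i → Fin.punchIn-injective v _ _ (begin
      punchIn v (lookup σ i)                ≡⟨ lookup-insert-punchIn p v σ i ⟨
      lookup (insert p v σ) (punchIn p i)   ≡⟨ cong (λ w → lookup w (punchIn p i)) eq ⟩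
      lookup (insert p v σ′) (punchIn p i)  ≡⟨ lookup-insert-punchIn p v σ′ i ⟩
      punchIn v (lookup σ′ i)               ∎)
  where open ≡-Reasoning

insert-IsPerm : ∀ p v {σ : Word m} → IsPerm σ → IsPerm (insert p v σ)
insert-IsPerm p v {σ} σ-perm {j} {j′} eq with pivot-or-punchIn p j | pivot-or-punchIn p j′
... | inj₁ refl       | inj₁ refl        = refl
... | inj₁ refl       | inj₂ (i′ , refl) = ⊥-elim (Fin.punchInᵢ≢i v (lookup σ i′)
  (trans (sym (lookup-insert-punchIn p v σ i′)) (trans (sym eq) (lookup-insert p v σ))))
... | inj₂ (i , refl) | inj₁ refl        = ⊥-elim (Fin.punchInᵢ≢i v (lookup σ i)
  (trans (sym (lookup-insert-punchIn p v σ i)) (trans eq (lookup-insert p v σ))))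
... | inj₂ (i , refl) | inj₂ (i′ , refl) = cong (punchIn p) (σ-perm (Fin.punchIn-injective v _ _
  (trans (sym (lookup-insert-punchIn p v σ i)) (trans eq (lookup-insert-punchIn p v σ i′)))))

insert-surjective : ∀ p {w : Word (suc m)} → IsPerm w → ∃ λ σ → IsPerm σ × insert p (lookup w p) σ ≡ w
insert-surjective {m} p {w} w-perm = σ , σ-perm , lookup-extensionality agree
  where
  v = lookup w p
  v≢ : ∀ i → v ≢ lookup w (punchIn p i)
  v≢ i v≡ = Fin.punchInᵢ≢i p i (sym (w-perm v≡))
  σ : Word m
  σ = Vec.tabulate (λ i → punchOut (v≢ i))
  σ-perm : IsPerm σ
  σ-perm {i} {i′} eq = Fin.punchIn-injective p i i′ (w-perm (Fin.punchOut-injective (v≢ i) (v≢ i′)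
    (trans (sym (Vec.lookup∘tabulate _ i)) (trans eq (Vec.lookup∘tabulate _ i′)))))
  agree : ∀ j → lookup (insert p v σ) j ≡ lookup w j
  agree j with pivot-or-punchIn p j
  ... | inj₁ refl       = lookup-insert p v σ
  ... | inj₂ (i , refl) = trans (lookup-insert-punchIn p v σ i)
    (trans (cong (punchIn v) (Vec.lookup∘tabulate _ i)) (Fin.punchIn-punchOut (v≢ i)))

perms-↭-insertions : ∀ m p → perms (suc m) ↭ cartesianProductWith (insert p) (allFin (suc m)) (perms m)
perms-↭-insertions m p = ∼bag⇒↭ (unique∧set⇒bag (perms-unique (suc m))
  (Unique.cartesianProductWith⁺ (insert p) (insert-injective p) (Unique.allFin⁺ (suc m)) (perms-unique m))
  (mk⇔ to from))
  where
  to : ∀ {w} → w ∈ perms (suc m) → w ∈ cartesianProductWith (insert p) (allFin (suc m)) (perms m)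
  to {w} w∈perms with σ , σ-perm , insertion ← insert-surjective p (∈-perms⁻ w∈perms) =
    subst (_∈ _) insertion (∈-cartesianProductWith⁺ (insert p) (∈-allFin _) (∈-perms⁺ σ-perm))
  from : ∀ {w} → w ∈ cartesianProductWith (insert p) (allFin (suc m)) (perms m) → w ∈ perms (suc m)
  from w∈insertions with v , σ , _ , σ∈perms , refl ← ∈-cartesianProductWith⁻ (insert p) (allFin (suc m)) (perms m) w∈insertions =
    ∈-perms⁺ (insert-IsPerm p v (∈-perms⁻ σ∈perms))

sumPerms : ∀ n → (Word n → ℕ) → ℕ
sumPerms n f = sum (map f (perms n))

sumPerms-insert : ∀ (f : Word (suc m) → ℕ) p e →
  sumPerms (suc m) f ≡ sumPerms m (f ∘ insert p e) + ∑[ v < m ] sumPerms m (f ∘ insert p (punchIn e v))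
sumPerms-insert {m} f p e = begin
  sumPerms (suc m) f
    ≡⟨ sum-map-↭ f (perms-↭-insertions m p) ⟩
  sum (map f (cartesianProductWith (insert p) (allFin (suc m)) (perms m)))
    ≡⟨ sum-map-cartesianProductWith f (insert p) (allFin (suc m)) (perms m) ⟩
  sum (map (λ v → sumPerms m (f ∘ insert p v)) (allFin (suc m)))
    ≡⟨ sum-map-allFin (λ v → sumPerms m (f ∘ insert p v)) ⟩
  ∑[ v < suc m ] sumPerms m (f ∘ insert p v)
    ≡⟨ sum-remove {i = e} (λ v → sumPerms m (f ∘ insert p v)) ⟩
  sumPerms m (f ∘ insert p e) + ∑[ v < m ] sumPerms m (f ∘ insert p (punchIn e v)) ∎
  where open ≡-Reasoning

sumPerms-cong : ∀ {f g : Word n → ℕ} → (∀ {σ} → IsPerm σ → f σ ≡ g σ) → sumPerms n f ≡ sumPerms n g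
sumPerms-cong {n} eq = cong sum (map-cong-local (All.tabulate {xs = perms n} (eq ∘ ∈-perms⁻)))

sumPerms-const : ∀ n c → sumPerms n (λ _ → c) ≡ n ! * c
sumPerms-const zero    c = refl
sumPerms-const (suc m) c = begin
  sumPerms (suc m) (λ _ → c)                                     ≡⟨ sumPerms-insert {m} (λ _ → c) zero zero ⟩
  sumPerms m (λ _ → c) + ∑[ v < m ] sumPerms m (λ _ → c)          ≡⟨ cong₂ _+_ (sumPerms-const m c)
                                                                      (trans (∑-const m _) (cong (m *_) (sumPerms-const m c))) ⟩
  m ! * c + m * (m ! * c)                                        ≡⟨ cong (m ! * c +_) (ℕ.*-assoc m (m !) c) ⟨
  m ! * c + m * m ! * c                                          ≡⟨ ℕ.*-distribʳ-+ c (m !) (m * m !) ⟨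
  suc m ! * c                                                    ∎
  where open ≡-Reasoning

-- Records and Stirling numbers

toℕ-punchIn-fromℕ : ∀ (x : Fin m) → toℕ (punchIn (fromℕ m) x) ≡ toℕ x
toℕ-punchIn-fromℕ {suc m} zero    = refl
toℕ-punchIn-fromℕ {suc m} (suc x) = cong suc (toℕ-punchIn-fromℕ x)

punchIn-<ᵇ : ∀ (v : Fin (suc n)) x y → (toℕ (punchIn v x) <ᵇ toℕ (punchIn v y)) ≡ (toℕ x <ᵇ toℕ y)
punchIn-<ᵇ zero    x       y       = refl
punchIn-<ᵇ (suc v) zero    zero    = refl
punchIn-<ᵇ (suc v) zero    (suc y) = refl
punchIn-<ᵇ (suc v) (suc x) zero    = refl
punchIn-<ᵇ (suc v) (suc x) (suc y) = punchIn-<ᵇ v x y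

data Side : Set where
  lt gt : Side

cmp : Side → ℕ → ℕ → Bool
cmp lt x y = x <ᵇ y
cmp gt x y = y <ᵇ x

opposite : Side → Side
opposite lt = gt
opposite gt = lt

cmp-opposite : ∀ s x y → cmp (opposite s) x y ≡ cmp s y x
cmp-opposite lt x y = refl
cmp-opposite gt x y = refl

cmp-irreflexive : ∀ s x → cmp s x x ≡ false
cmp-irreflexive lt x = <ᵇ-false {x} {x} ℕ.≤-refl
cmp-irreflexive gt x = <ᵇ-false {x} {x} ℕ.≤-refl

cmp-punchIn : ∀ s (v : Fin (suc n)) x y → cmp s (toℕ (punchIn v x)) (toℕ (punchIn v y)) ≡ cmp s (toℕ x) (toℕ y)
cmp-punchIn lt v x y = punchIn-<ᵇ v x y
cmp-punchIn gt v x y = punchIn-<ᵇ v y x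

extremum : Side → (m : ℕ) → Fin (suc m)
extremum lt m = zero
extremum gt m = fromℕ m

nothing-beyond-extremum : ∀ s (j : Fin (suc m)) → cmp s (toℕ j) (toℕ (extremum s m)) ≡ false
nothing-beyond-extremum lt j = refl
nothing-beyond-extremum {m} gt j = trans (cong (_<ᵇ toℕ j) (Fin.toℕ-fromℕ m)) (<ᵇ-false (s≤s⁻¹ (Fin.toℕ<n j)))

extremum-beyond-punchIn : ∀ s (j : Fin m) → cmp s (toℕ (extremum s m)) (toℕ (punchIn (extremum s m) j)) ≡ true
extremum-beyond-punchIn lt j = refl
extremum-beyond-punchIn {m} gt j =
  trans (cong₂ _<ᵇ_ (toℕ-punchIn-fromℕ j) (Fin.toℕ-fromℕ m)) (<ᵇ-true (Fin.toℕ<n j))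

-- The (lt , gt)-records are the left-to-right maxima, the (gt , lt)-records the right-to-left
-- minima, and so on.
blocks : Side → Side → Word m → Fin m → Fin m → Bool
blocks cP cV σ k i = cmp cP (toℕ k) (toℕ i) ∧ cmp cV (toℕ (lookup σ k)) (toℕ (lookup σ i))

isRecord : Side → Side → Word m → Fin m → Bool
isRecord cP cV σ i = not (⋁ λ k → blocks cP cV σ k i)

records : Side → Side → Word m → ℕ
records cP cV σ = ∑ (𝟙 ∘ isRecord cP cV σ)

module _ (cP cV : Side) {m : ℕ} (σ : Word m) where
  private
    p : Fin (suc m)
    p = extremum (opposite cP) m

    p-beyond-nothing : ∀ j → cmp cP (toℕ p) (toℕ j) ≡ false
    p-beyond-nothing j = trans (sym (cmp-opposite cP (toℕ j) (toℕ p))) (nothing-beyond-extremum (opposite cP) j)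

    punchIn-beyond-p : ∀ k → cmp cP (toℕ (punchIn p k)) (toℕ p) ≡ true
    punchIn-beyond-p k = trans (sym (cmp-opposite cP _ _)) (extremum-beyond-punchIn (opposite cP) k)

  isRecord-insert-punchIn : ∀ v i → isRecord cP cV (insert p v σ) (punchIn p i) ≡ isRecord cP cV σ i
  isRecord-insert-punchIn v i = cong not (begin
    ⋁ (λ k → blocks cP cV π k (punchIn p i))
      ≡⟨ ⋁-remove {i = p} (λ k → blocks cP cV π k (punchIn p i)) ⟩
    blocks cP cV π p (punchIn p i) ∨ ⋁ (λ k → blocks cP cV π (punchIn p k) (punchIn p i))
      ≡⟨ cong₂ _∨_ (cong₂ _∧_ (p-beyond-nothing (punchIn p i)) refl) (⋁-cong unshifted) ⟩
    ⋁ (λ k → blocks cP cV σ k i) ∎)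
    where
    open ≡-Reasoning
    π = insert p v σ
    unshifted : ∀ k → blocks cP cV π (punchIn p k) (punchIn p i) ≡ blocks cP cV σ k i
    unshifted k = cong₂ _∧_ (cmp-punchIn cP p k i)
      (trans (cong₂ (λ a b → cmp cV (toℕ a) (toℕ b)) (lookup-insert-punchIn p v σ k) (lookup-insert-punchIn p v σ i))
             (cmp-punchIn cV v (lookup σ k) (lookup σ i)))

  isRecord-insert-pivot : ∀ v → isRecord cP cV (insert p v σ) p ≡ not (⋁ λ k → cmp cV (toℕ (punchIn v (lookup σ k))) (toℕ v))
  isRecord-insert-pivot v = cong not (begin
    ⋁ (λ k → blocks cP cV π k p)
      ≡⟨ ⋁-remove {i = p} (λ k → blocks cP cV π k p) ⟩
    blocks cP cV π p p ∨ ⋁ (λ k → blocks cP cV π (punchIn p k) p)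
      ≡⟨ cong₂ _∨_ (cong₂ _∧_ (cmp-irreflexive cP (toℕ p)) refl) (⋁-cong value-test) ⟩
    ⋁ (λ k → cmp cV (toℕ (punchIn v (lookup σ k))) (toℕ v)) ∎)
    where
    open ≡-Reasoning
    π = insert p v σ
    value-test : ∀ k → blocks cP cV π (punchIn p k) p ≡ cmp cV (toℕ (punchIn v (lookup σ k))) (toℕ v)
    value-test k = cong₂ _∧_ (punchIn-beyond-p k)
      (cong₂ (λ a b → cmp cV (toℕ a) (toℕ b)) (lookup-insert-punchIn p v σ k) (lookup-insert p v σ))

  records-insert : ∀ v → records cP cV (insert p v σ) ≡ 𝟙 (isRecord cP cV (insert p v σ) p) + records cP cV σ
  records-insert v = trans (sum-remove {i = p} (𝟙 ∘ isRecord cP cV (insert p v σ)))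
    (cong (𝟙 (isRecord cP cV (insert p v σ) p) +_) (sum-cong-≗ (cong 𝟙 ∘ isRecord-insert-punchIn v)))

  records-insert-extremum : records cP cV (insert p (extremum cV m) σ) ≡ suc (records cP cV σ)
  records-insert-extremum = trans (records-insert e) (cong (λ b → 𝟙 b + records cP cV σ)
    (trans (isRecord-insert-pivot e) (cong not (trans (⋁-cong (nothing-beyond-extremum cV ∘ punchIn e ∘ lookup σ)) (⋁-false m)))))
    where e = extremum cV m

  records-insert-other : IsPerm σ → ∀ u → records cP cV (insert p (punchIn (extremum cV m) u) σ) ≡ records cP cV σ
  records-insert-other σ-perm u = trans (records-insert v) (cong (λ b → 𝟙 b + records cP cV σ)
    (trans (isRecord-insert-pivot v) (cong not (⋁-witness (λ k → cmp cV (toℕ (punchIn v (lookup σ k))) (toℕ v)) k beyond))))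
    where
    e = extremum cV m
    v = punchIn e u
    v≢e : v ≢ e
    v≢e = Fin.punchInᵢ≢i e u
    hit = IsPerm⇒surjective {w = σ} σ-perm (punchOut v≢e)
    k = proj₁ hit
    beyond : cmp cV (toℕ (punchIn v (lookup σ k))) (toℕ v) ≡ true
    beyond = trans (cong (λ x → cmp cV (toℕ (punchIn v x)) (toℕ v)) (proj₂ hit))
      (trans (cong (λ x → cmp cV (toℕ x) (toℕ v)) (Fin.punchIn-punchOut v≢e)) (extremum-beyond-punchIn cV u))

stirling : ℕ → ℕ → ℕ
stirling zero    zero    = 1
stirling zero    (suc k) = 0
stirling (suc m) zero    = m * stirling m zero
stirling (suc m) (suc k) = m * stirling m (suc k) + stirling m k

recordCount : Side → Side → ℕ → ℕ → ℕ
recordCount cP cV m k = sumPerms m (λ σ → 𝟙 (records cP cV σ ≡ᵇ k))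

recordCount-suc : ∀ cP cV m k → recordCount cP cV (suc m) k ≡
  sumPerms m (λ σ → 𝟙 (suc (records cP cV σ) ≡ᵇ k)) + m * recordCount cP cV m k
recordCount-suc cP cV m k = trans (sumPerms-insert {m} (λ π → 𝟙 (records cP cV π ≡ᵇ k)) (extremum (opposite cP) m) (extremum cV m)) (cong₂ _+_
  (sumPerms-cong {m} λ {σ} _ → cong (λ r → 𝟙 (r ≡ᵇ k)) (records-insert-extremum cP cV σ))
  (trans (sum-cong-≗ λ u → sumPerms-cong {m} λ {σ} σ-perm → cong (λ r → 𝟙 (r ≡ᵇ k)) (records-insert-other cP cV σ σ-perm u))
         (∑-const m _)))

recordCount≡stirling : ∀ cP cV m k → recordCount cP cV m k ≡ stirling m k
recordCount≡stirling cP cV zero    zero    = refl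
recordCount≡stirling cP cV zero    (suc k) = refl
recordCount≡stirling cP cV (suc m) zero    = trans (recordCount-suc cP cV m zero)
  (cong₂ _+_ (trans (sumPerms-const m 0) (ℕ.*-zeroʳ (m !))) (cong (m *_) (recordCount≡stirling cP cV m zero)))
recordCount≡stirling cP cV (suc m) (suc k) = trans (recordCount-suc cP cV m (suc k))
  (trans (cong₂ _+_ (recordCount≡stirling cP cV m k) (cong (m *_) (recordCount≡stirling cP cV m (suc k))))
         (ℕ.+-comm (stirling m k) _))

-- Occurrences of the mesh patterns

-- The 0-based coordinate y lies strictly inside strip a of the lines 0 < x₁+1 < x₂+1 < n+1,
-- the 1-based positions (or values) of Defs.
inStrip : (x₁ x₂ n : ℕ) → Fin 3 → ℕ → Bool
inStrip x₁ x₂ n a y = btw (coord (suc x₁) (suc x₂) (suc n) (inject₁ a)) (suc y) (coord (suc x₁) (suc x₂) (suc n) (suc a))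

inBox : Word n → Fin n → Fin n → Box → Fin n → Bool
inBox {n} w i₁ i₂ (a , b) k =
  inStrip (toℕ i₁) (toℕ i₂) n a (toℕ k) ∧ inStrip (toℕ (lookup w i₁)) (toℕ (lookup w i₂)) n b (toℕ (lookup w k))

boxEmpty≡ : ∀ (w : Word n) i₁ i₂ b → boxEmpty w i₁ i₂ b ≡ not (⋁ (inBox w i₁ i₂ b))
boxEmpty≡ w i₁ i₂ b = cong not (any-allFin (inBox w i₁ i₂ b))

boxEmpty-intro : ∀ (w : Word n) i₁ i₂ b → (∀ k → inBox w i₁ i₂ b k ≡ false) → boxEmpty w i₁ i₂ b ≡ true
boxEmpty-intro {n} w i₁ i₂ b empty = trans (boxEmpty≡ w i₁ i₂ b) (cong not (trans (⋁-cong empty) (⋁-false n)))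

inStrip-cong : ∀ {x₁ x₁′ x₂ x₂′ y y′} n a → x₁ ≡ x₁′ → x₂ ≡ x₂′ → y ≡ y′ → inStrip x₁ x₂ n a y ≡ inStrip x₁′ x₂′ n a y′
inStrip-cong n a refl refl refl = refl

inStrip-below : ∀ {x₁ y} x₂ n → y < x₁ → T (inStrip x₁ x₂ n f0 y)
inStrip-below x₂ n = ℕ.<⇒<ᵇ

inStrip-above : ∀ x₁ {x₂ y n} → x₂ < y → y < n → T (inStrip x₁ x₂ n f2 y)
inStrip-above x₁ {x₂} {y} {n} x₂<y y<n = Equivalence.from (𝔹.T-∧ {x₂ <ᵇ y} {y <ᵇ n}) (ℕ.<⇒<ᵇ x₂<y , ℕ.<⇒<ᵇ y<n)

inStrip-some : ∀ {x₁ x₂ y n} → y ≢ x₁ → y ≢ x₂ → y < n → ∃ λ a → T (inStrip x₁ x₂ n a y)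
inStrip-some {x₁} {x₂} {y} {n} y≢x₁ y≢x₂ y<n with ℕ.<-cmp y x₁ | ℕ.<-cmp y x₂
... | tri< y<x₁ _ _ | _             = f0 , inStrip-below x₂ n y<x₁
... | tri≈ _ y≡x₁ _ | _             = ⊥-elim (y≢x₁ y≡x₁)
... | tri> _ _ x₁<y | tri< y<x₂ _ _ = f1 , Equivalence.from (𝔹.T-∧ {x₁ <ᵇ y} {y <ᵇ x₂}) (ℕ.<⇒<ᵇ x₁<y , ℕ.<⇒<ᵇ y<x₂)
... | tri> _ _ _    | tri≈ _ y≡x₂ _ = ⊥-elim (y≢x₂ y≡x₂)
... | tri> _ _ _    | tri> _ _ x₂<y = f2 , inStrip-above x₁ x₂<y y<n

record Occurrence (R : MeshR) (w : Word n) (i₁ i₂ : Fin n) : Set where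
  field
    positions< : toℕ i₁ < toℕ i₂
    values<    : toℕ (lookup w i₁) < toℕ (lookup w i₂)
    empty      : ∀ {b} → b ∈ R → ∀ k → ¬ T (inBox w i₁ i₂ b k)

occurrence : ∀ R (w : Word n) i₁ i₂ → T (isOcc R w i₁ i₂) → Occurrence R w i₁ i₂
occurrence R w i₁ i₂ t = record
  { positions< = ℕ.<ᵇ⇒< _ _ (proj₁ positions-rest)
  ; values<    = ℕ.<ᵇ⇒< _ _ (proj₁ values-boxes)
  ; empty      = λ {b} b∈R → ⋁-false⁻ (inBox w i₁ i₂ b)
      (subst T (boxEmpty≡ w i₁ i₂ b) (All.lookup (all⁺ (boxEmpty w i₁ i₂) R (proj₂ values-boxes)) b∈R))
  }
  where
  values = toℕ (lookup w i₁) <ᵇ toℕ (lookup w i₂)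
  positions-rest = Equivalence.to (𝔹.T-∧ {toℕ i₁ <ᵇ toℕ i₂} {values ∧ all (boxEmpty w i₁ i₂) R}) t
  values-boxes   = Equivalence.to (𝔹.T-∧ {values} {all (boxEmpty w i₁ i₂) R}) (proj₂ positions-rest)

no-occurrence-at : ∀ R (w : Word n) i → ¬ T (isOcc R w i i)
no-occurrence-at R w i t = ℕ.<-irrefl refl (Occurrence.positions< (occurrence R w i i t))

-- Any other point of w lies in the box given by its column and row strips, so a shaded outer
-- row or column leaves no point beyond the occurrence.
module _ {R : MeshR} {w : Word n} {i₁ i₂ : Fin n} (w-perm : IsPerm w) (o : Occurrence R w i₁ i₂) where
  open Occurrence o

  private
    in-box : ∀ {a b} k → (a , b) ∈ R → T (inStrip (toℕ i₁) (toℕ i₂) n a (toℕ k)) →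
             T (inStrip (toℕ (lookup w i₁)) (toℕ (lookup w i₂)) n b (toℕ (lookup w k))) → ⊥
    in-box {a} {b} k ab∈R column row = empty ab∈R k (Equivalence.from (𝔹.T-∧
      {inStrip (toℕ i₁) (toℕ i₂) n a (toℕ k)} {inStrip (toℕ (lookup w i₁)) (toℕ (lookup w i₂)) n b (toℕ (lookup w k))})
      (column , row))

    column-of : ∀ k → toℕ (lookup w k) ≢ toℕ (lookup w i₁) → toℕ (lookup w k) ≢ toℕ (lookup w i₂) →
                ∃ λ a → T (inStrip (toℕ i₁) (toℕ i₂) n a (toℕ k))
    column-of k ≢₁ ≢₂ = inStrip-some (≢₁ ∘ cong (toℕ ∘ lookup w) ∘ Fin.toℕ-injective)
                                      (≢₂ ∘ cong (toℕ ∘ lookup w) ∘ Fin.toℕ-injective) (Fin.toℕ<n k)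

    row-of : ∀ k → toℕ k ≢ toℕ i₁ → toℕ k ≢ toℕ i₂ →
             ∃ λ b → T (inStrip (toℕ (lookup w i₁)) (toℕ (lookup w i₂)) n b (toℕ (lookup w k)))
    row-of k ≢₁ ≢₂ = inStrip-some (≢₁ ∘ cong toℕ ∘ w-perm ∘ Fin.toℕ-injective)
                                   (≢₂ ∘ cong toℕ ∘ w-perm ∘ Fin.toℕ-injective) (Fin.toℕ<n (lookup w k))

  nothing-above : (∀ a → (a , f2) ∈ R) → ∀ k → toℕ (lookup w k) ≤ toℕ (lookup w i₂)
  nothing-above top k = ℕ.≮⇒≥ λ above →
    let a , column = column-of k (ℕ.>⇒≢ (ℕ.<-trans values< above)) (ℕ.>⇒≢ above)
    in  in-box k (top a) column (inStrip-above (toℕ (lookup w i₁)) above (Fin.toℕ<n (lookup w k)))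

  nothing-right : (∀ b → (f2 , b) ∈ R) → ∀ k → toℕ k ≤ toℕ i₂
  nothing-right right k = ℕ.≮⇒≥ λ after →
    let b , row = row-of k (ℕ.>⇒≢ (ℕ.<-trans positions< after)) (ℕ.>⇒≢ after)
    in  in-box k (right b) (inStrip-above (toℕ i₁) after (Fin.toℕ<n k)) row

  nothing-below : (∀ a → (a , f0) ∈ R) → ∀ k → toℕ (lookup w i₁) ≤ toℕ (lookup w k)
  nothing-below bottom k = ℕ.≮⇒≥ λ below →
    let a , column = column-of k (ℕ.<⇒≢ below) (ℕ.<⇒≢ (ℕ.<-trans below values<))
    in  in-box k (bottom a) column (inStrip-below (toℕ (lookup w i₂)) n below)

  nothing-left : (∀ b → (f0 , b) ∈ R) → ∀ k → toℕ i₁ ≤ toℕ k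
  nothing-left left k = ℕ.≮⇒≥ λ before →
    let b , row = row-of k (ℕ.<⇒≢ before) (ℕ.<⇒≢ (ℕ.<-trans before positions<))
    in  in-box k (left b) (inStrip-below (toℕ i₂) n before) row

occurrence-top-right : ∀ {R} {w : Word (suc m)} {i₁ i₂} → IsPerm w → (∀ a → (a , f2) ∈ R) → (∀ b → (f2 , b) ∈ R) →
                       Occurrence R w i₁ i₂ → i₂ ≡ fromℕ m × lookup w i₂ ≡ fromℕ m
occurrence-top-right {m} {w = w} {i₂ = i₂} w-perm top right o =
    Fin.≤-antisym (Fin.≤fromℕ i₂) (nothing-right w-perm o right (fromℕ m))
  , Fin.≤-antisym (Fin.≤fromℕ (lookup w i₂))
      (subst (λ v → toℕ v ≤ toℕ (lookup w i₂)) (proj₂ max) (nothing-above w-perm o top (proj₁ max)))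
  where max = IsPerm⇒surjective {w = w} w-perm (fromℕ m)

occurrence-bottom-left : ∀ {R} {w : Word (suc m)} {i₁ i₂} → IsPerm w → (∀ a → (a , f0) ∈ R) → (∀ b → (f0 , b) ∈ R) →
                         Occurrence R w i₁ i₂ → i₁ ≡ zero × lookup w i₁ ≡ zero
occurrence-bottom-left {m} {w = w} {i₁ = i₁} w-perm bottom left o =
    Fin.≤-antisym (nothing-left w-perm o left zero) z≤n
  , Fin.≤-antisym (subst (λ v → toℕ (lookup w i₁) ≤ toℕ v) (proj₂ min) (nothing-below w-perm o bottom (proj₁ min))) z≤n
  where min = IsPerm⇒surjective {w = w} w-perm zero

isOcc-single-box : ∀ {R E} (w : Word n) i₁ i₂ → toℕ i₁ < toℕ i₂ → toℕ (lookup w i₁) < toℕ (lookup w i₂) → E ∈ R →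
                   All.All (λ b → boxEmpty w i₁ i₂ b ≡ true ⊎ b ≡ E) R → isOcc R w i₁ i₂ ≡ boxEmpty w i₁ i₂ E
isOcc-single-box {R = R} w i₁ i₂ pos< val< E∈R others =
  trans (cong₂ (λ x y → x ∧ y ∧ all (boxEmpty w i₁ i₂) R) (<ᵇ-true pos<) (<ᵇ-true val<))
        (all-except (boxEmpty w i₁ i₂) E∈R others)

occ≡∑∑ : ∀ R (w : Word n) → occ R w ≡ ∑[ i₁ < n ] ∑[ i₂ < n ] 𝟙 (isOcc R w i₁ i₂)
occ≡∑∑ {n} R w = begin
  occ R w
    ≡⟨ length-filterᵇ (λ ij → isOcc R w (proj₁ ij) (proj₂ ij)) (cartesianProductWith _,_ (allFin n) (allFin n)) ⟩
  sum (map (λ ij → 𝟙 (isOcc R w (proj₁ ij) (proj₂ ij))) (cartesianProductWith _,_ (allFin n) (allFin n)))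
    ≡⟨ sum-map-cartesianProductWith (λ ij → 𝟙 (isOcc R w (proj₁ ij) (proj₂ ij))) _,_ (allFin n) (allFin n) ⟩
  sum (map (λ i₁ → sum (map (λ i₂ → 𝟙 (isOcc R w i₁ i₂)) (allFin n))) (allFin n))
    ≡⟨ sum-map-allFin (λ i₁ → sum (map (λ i₂ → 𝟙 (isOcc R w i₁ i₂)) (allFin n))) ⟩
  ∑[ i₁ < n ] sum (map (λ i₂ → 𝟙 (isOcc R w i₁ i₂)) (allFin n))
    ≡⟨ sum-cong-≗ (λ i₁ → sum-map-allFin (λ i₂ → 𝟙 (isOcc R w i₁ i₂))) ⟩
  ∑[ i₁ < n ] ∑[ i₂ < n ] 𝟙 (isOcc R w i₁ i₂) ∎
  where open ≡-Reasoning

sFormula : ℕ → ℕ → ℕ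
sFormula zero    k = 𝟙 (0 ≡ᵇ k)
sFormula (suc m) k = stirling m k + m * (m ! * 𝟙 (0 ≡ᵇ k))

s-zero : ∀ R k → s R 0 k ≡ sFormula 0 k
s-zero R k = trans (length-filterᵇ (λ w → occ R w ≡ᵇ k) (perms 0)) (ℕ.+-identityʳ _)

s-by-insertion : ∀ R {m} (p e : Fin (suc m)) cP cV →
  (∀ {σ} → IsPerm σ → occ R (insert p e σ) ≡ records cP cV σ) →
  (∀ {σ} → IsPerm σ → ∀ u → occ R (insert p (punchIn e u) σ) ≡ 0) →
  ∀ k → s R (suc m) k ≡ sFormula (suc m) k
s-by-insertion R {m} p e cP cV occ-records occ-zero k = begin
  s R (suc m) k
    ≡⟨ length-filterᵇ (λ w → occ R w ≡ᵇ k) (perms (suc m)) ⟩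
  sumPerms (suc m) (λ w → 𝟙 (occ R w ≡ᵇ k))
    ≡⟨ sumPerms-insert {m} (λ w → 𝟙 (occ R w ≡ᵇ k)) p e ⟩
  sumPerms m (λ σ → 𝟙 (occ R (insert p e σ) ≡ᵇ k)) + ∑[ u < m ] sumPerms m (λ σ → 𝟙 (occ R (insert p (punchIn e u) σ) ≡ᵇ k))
    ≡⟨ cong₂ _+_ (sumPerms-cong {m} (cong (λ r → 𝟙 (r ≡ᵇ k)) ∘ occ-records))
                 (sum-cong-≗ λ u → sumPerms-cong {m} λ σ-perm → cong (λ r → 𝟙 (r ≡ᵇ k)) (occ-zero σ-perm u)) ⟩
  recordCount cP cV m k + ∑[ u < m ] sumPerms m (λ _ → 𝟙 (0 ≡ᵇ k))
    ≡⟨ cong₂ _+_ (recordCount≡stirling cP cV m k) (trans (∑-const m _) (cong (m *_) (sumPerms-const m _))) ⟩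
  stirling m k + m * (m ! * 𝟙 (0 ≡ᵇ k)) ∎
  where open ≡-Reasoning

-- The two families of patterns

record Shape (o : Fin 3) (E : Box) (R : MeshR) : Set where
  constructor shape
  field
    row    : ∀ c → (c , o) ∈ R
    column : ∀ c → (o , c) ∈ R
    E∈R    : E ∈ R
    others : All.All (λ box → proj₂ box ≡ o ⊎ proj₁ box ≡ o ⊎ box ≡ E) R

side : Fin 2 → Side
side 0F = lt
side 1F = gt

not-inStrip-above : ∀ {x₁ x₂ y} n → y ≤ x₂ → inStrip x₁ x₂ n f2 y ≡ false
not-inStrip-above {y = y} n y≤x₂ = cong (_∧ (y <ᵇ n)) (<ᵇ-false y≤x₂)

inBox-top-row : ∀ (w : Word n) i₁ i₂ c k → toℕ (lookup w k) ≤ toℕ (lookup w i₂) → inBox w i₁ i₂ (c , f2) k ≡ false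
inBox-top-row {n} w i₁ i₂ c k below =
  trans (cong (inStrip (toℕ i₁) (toℕ i₂) n c (toℕ k) ∧_) (not-inStrip-above {toℕ (lookup w i₁)} n below))
        (𝔹.∧-zeroʳ (inStrip (toℕ i₁) (toℕ i₂) n c (toℕ k)))

inBox-right-column : ∀ (w : Word n) i₁ i₂ c k → toℕ k ≤ toℕ i₂ → inBox w i₁ i₂ (f2 , c) k ≡ false
inBox-right-column {n} w i₁ i₂ c k left =
  cong (_∧ inStrip (toℕ (lookup w i₁)) (toℕ (lookup w i₂)) n c (toℕ (lookup w k))) (not-inStrip-above {toℕ i₁} n left)

inBox-bottom-row : ∀ (w : Word n) i₁ i₂ c k → toℕ (lookup w i₁) ≡ 0 → inBox w i₁ i₂ (c , f0) k ≡ false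
inBox-bottom-row {n} w i₁ i₂ c k w₁≡0 rewrite w₁≡0 = 𝔹.∧-zeroʳ (inStrip (toℕ i₁) (toℕ i₂) n c (toℕ k))

inBox-left-column : ∀ (w : Word n) i₁ i₂ c k → toℕ i₁ ≡ 0 → inBox w i₁ i₂ (f0 , c) k ≡ false
inBox-left-column w i₁ i₂ c k i₁≡0 rewrite i₁≡0 = refl

inStrip-top-inner : ∀ a {x y m} → y < m → inStrip x m (suc m) (inject₁ a) y ≡ cmp (side a) y x
inStrip-top-inner zero       y<m = refl
inStrip-top-inner (suc zero) {x} {y} y<m = trans (cong ((x <ᵇ y) ∧_) (<ᵇ-true y<m)) (𝔹.∧-identityʳ (x <ᵇ y))

inStrip-top-corner : ∀ a {x m} → x < m → inStrip x m (suc m) (inject₁ a) m ≡ false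
inStrip-top-corner zero       x<m = <ᵇ-false (ℕ.<⇒≤ x<m)
inStrip-top-corner (suc zero) {x} {m} x<m = trans (cong ((x <ᵇ m) ∧_) (<ᵇ-false {m} {m} ℕ.≤-refl)) (𝔹.∧-zeroʳ (x <ᵇ m))

inStrip-bottom-inner : ∀ a {x y m} → y < m → inStrip 0 (suc x) (suc m) (suc a) (suc y) ≡ cmp (side a) y x
inStrip-bottom-inner zero       y<m = refl
inStrip-bottom-inner (suc zero) {x} {y} y<m = trans (cong ((x <ᵇ y) ∧_) (<ᵇ-true y<m)) (𝔹.∧-identityʳ (x <ᵇ y))

inStrip-bottom-corner : ∀ a {x m} → inStrip 0 (suc x) (suc m) (suc a) 0 ≡ false
inStrip-bottom-corner zero       = refl
inStrip-bottom-corner (suc zero) = refl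

module MaxFamily {R : MeshR} (a b : Fin 2) (sh : Shape f2 (inject₁ a , inject₁ b) R) where
  open Shape sh

  module _ {m : ℕ} (σ : Word m) where
    private
      E : Box
      E = (inject₁ a , inject₁ b)
      L = fromℕ m
      π = insert L L σ

      toℕ-L : toℕ L ≡ m
      toℕ-L = Fin.toℕ-fromℕ m

      value-L : toℕ (lookup π L) ≡ m
      value-L = trans (cong toℕ (lookup-insert L L σ)) toℕ-L

      value : ∀ j → toℕ (lookup π (punchIn L j)) ≡ toℕ (lookup σ j)
      value j = trans (cong toℕ (lookup-insert-punchIn L L σ j)) (toℕ-punchIn-fromℕ (lookup σ j))

    boxEmpty-insert-max : ∀ i → boxEmpty π (punchIn L i) L E ≡ isRecord (side a) (side b) σ i
    boxEmpty-insert-max i = trans (boxEmpty≡ π (punchIn L i) L E)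
      (cong not (trans (⋁-remove {i = L} (inBox π (punchIn L i) L E)) (cong₂ _∨_ corner (⋁-cong inner))))
      where
      corner : inBox π (punchIn L i) L E L ≡ false
      corner = cong₂ _∧_ (trans (inStrip-cong (suc m) (inject₁ a) (toℕ-punchIn-fromℕ i) toℕ-L toℕ-L)
                                (inStrip-top-corner a (Fin.toℕ<n i))) refl
      inner : ∀ k → inBox π (punchIn L i) L E (punchIn L k) ≡ blocks (side a) (side b) σ k i
      inner k = cong₂ _∧_
        (trans (inStrip-cong (suc m) (inject₁ a) (toℕ-punchIn-fromℕ i) toℕ-L (toℕ-punchIn-fromℕ k))
               (inStrip-top-inner a (Fin.toℕ<n k)))
        (trans (inStrip-cong (suc m) (inject₁ b) (value i) value-L (value k))
               (inStrip-top-inner b (Fin.toℕ<n (lookup σ k))))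

    isOcc-insert-max : ∀ i → isOcc R π (punchIn L i) L ≡ isRecord (side a) (side b) σ i
    isOcc-insert-max i = trans (isOcc-single-box π (punchIn L i) L pos< val< E∈R (All.map trivial others))
                               (boxEmpty-insert-max i)
      where
      pos< : toℕ (punchIn L i) < toℕ L
      pos< = subst₂ _<_ (sym (toℕ-punchIn-fromℕ i)) (sym toℕ-L) (Fin.toℕ<n i)
      val< : toℕ (lookup π (punchIn L i)) < toℕ (lookup π L)
      val< = subst₂ _<_ (sym (value i)) (sym value-L) (Fin.toℕ<n (lookup σ i))
      trivial : ∀ {box} → proj₂ box ≡ f2 ⊎ proj₁ box ≡ f2 ⊎ box ≡ E → boxEmpty π (punchIn L i) L box ≡ true ⊎ box ≡ E
      trivial {c , _} (inj₁ refl)        = inj₁ (boxEmpty-intro π (punchIn L i) L (c , f2) λ k →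
        inBox-top-row π (punchIn L i) L c k (subst (toℕ (lookup π k) ≤_) (sym value-L) (s≤s⁻¹ (Fin.toℕ<n (lookup π k)))))
      trivial {_ , c} (inj₂ (inj₁ refl)) = inj₁ (boxEmpty-intro π (punchIn L i) L (f2 , c) λ k →
        inBox-right-column π (punchIn L i) L c k (subst (toℕ k ≤_) (sym toℕ-L) (s≤s⁻¹ (Fin.toℕ<n k))))
      trivial         (inj₂ (inj₂ refl)) = inj₂ refl

    occ-insert-max : IsPerm σ → occ R π ≡ records (side a) (side b) σ
    occ-insert-max σ-perm = begin
      occ R π
        ≡⟨ occ≡∑∑ R π ⟩
      ∑[ i₁ < suc m ] ∑[ i₂ < suc m ] 𝟙 (isOcc R π i₁ i₂)
        ≡⟨ sum-cong-≗ (λ i₁ → ∑-concentrated (λ i₂ → 𝟙 (isOcc R π i₁ i₂)) L (𝟙-false ∘ not-last i₁)) ⟩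
      ∑[ i₁ < suc m ] 𝟙 (isOcc R π i₁ L)
        ≡⟨ sum-remove {i = L} (λ i₁ → 𝟙 (isOcc R π i₁ L)) ⟩
      𝟙 (isOcc R π L L) + ∑[ i < m ] 𝟙 (isOcc R π (punchIn L i) L)
        ≡⟨ cong₂ _+_ (𝟙-false (no-occurrence-at R π L)) (sum-cong-≗ (cong 𝟙 ∘ isOcc-insert-max)) ⟩
      records (side a) (side b) σ ∎
      where
      open ≡-Reasoning
      not-last : ∀ i₁ j → ¬ T (isOcc R π i₁ (punchIn L j))
      not-last i₁ j t = Fin.punchInᵢ≢i L j (proj₁ (occurrence-top-right (insert-IsPerm L L σ-perm) row column
                                                     (occurrence R π i₁ (punchIn L j) t)))

    occ-insert-other : IsPerm σ → ∀ u → occ R (insert L (punchIn L u) σ) ≡ 0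
    occ-insert-other σ-perm u = trans (occ≡∑∑ R π′) (∑-zero λ i₁ → ∑-zero λ i₂ → 𝟙-false (impossible i₁ i₂))
      where
      π′ = insert L (punchIn L u) σ
      impossible : ∀ i₁ i₂ → ¬ T (isOcc R π′ i₁ i₂)
      impossible i₁ i₂ t
        with refl , max ← occurrence-top-right (insert-IsPerm L (punchIn L u) σ-perm) row column (occurrence R π′ i₁ i₂ t)
        = Fin.punchInᵢ≢i L u (trans (sym (lookup-insert L (punchIn L u) σ)) max)

  s≡sFormula : ∀ n k → s R n k ≡ sFormula n k
  s≡sFormula zero    = s-zero R
  s≡sFormula (suc m) = s-by-insertion R (fromℕ m) (fromℕ m) (side a) (side b)
                         (λ {σ} → occ-insert-max σ) (λ {σ} → occ-insert-other σ)

module MinFamily {R : MeshR} (a b : Fin 2) (sh : Shape f0 (suc a , suc b) R) where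
  open Shape sh

  module _ {m : ℕ} (σ : Word m) where
    private
      E : Box
      E = (suc a , suc b)
      π = insert zero zero σ

      value : ∀ j → toℕ (lookup π (suc j)) ≡ suc (toℕ (lookup σ j))
      value j = cong toℕ (lookup-insert-punchIn zero zero σ j)

    boxEmpty-insert-min : ∀ i → boxEmpty π zero (suc i) E ≡ isRecord (side a) (side b) σ i
    boxEmpty-insert-min i = trans (boxEmpty≡ π zero (suc i) E) (cong not (cong₂ _∨_ corner (⋁-cong inner)))
      where
      corner : inBox π zero (suc i) E zero ≡ false
      corner = cong₂ _∧_ (inStrip-bottom-corner a) refl
      inner : ∀ k → inBox π zero (suc i) E (suc k) ≡ blocks (side a) (side b) σ k i
      inner k = cong₂ _∧_ (inStrip-bottom-inner a (Fin.toℕ<n k))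
        (trans (inStrip-cong (suc m) (suc b) refl (value i) (value k)) (inStrip-bottom-inner b (Fin.toℕ<n (lookup σ k))))

    isOcc-insert-min : ∀ i → isOcc R π zero (suc i) ≡ isRecord (side a) (side b) σ i
    isOcc-insert-min i = trans (isOcc-single-box π zero (suc i) (s≤s z≤n) (subst (0 <_) (sym (value i)) (s≤s z≤n)) E∈R
                                                 (All.map trivial others))
                               (boxEmpty-insert-min i)
      where
      trivial : ∀ {box} → proj₂ box ≡ f0 ⊎ proj₁ box ≡ f0 ⊎ box ≡ E → boxEmpty π zero (suc i) box ≡ true ⊎ box ≡ E
      trivial {c , _} (inj₁ refl)        = inj₁ (boxEmpty-intro π zero (suc i) (c , f0) λ k →
        inBox-bottom-row π zero (suc i) c k refl)
      trivial {_ , c} (inj₂ (inj₁ refl)) = inj₁ (boxEmpty-intro π zero (suc i) (f0 , c) λ k →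
        inBox-left-column π zero (suc i) c k refl)
      trivial         (inj₂ (inj₂ refl)) = inj₂ refl

    occ-insert-min : IsPerm σ → occ R π ≡ records (side a) (side b) σ
    occ-insert-min σ-perm = begin
      occ R π
        ≡⟨ occ≡∑∑ R π ⟩
      ∑[ i₁ < suc m ] ∑[ i₂ < suc m ] 𝟙 (isOcc R π i₁ i₂)
        ≡⟨ ∑-concentrated (λ i₁ → ∑[ i₂ < suc m ] 𝟙 (isOcc R π i₁ i₂)) zero
             (λ j → ∑-zero λ i₂ → 𝟙-false (not-first j i₂)) ⟩
      𝟙 (isOcc R π zero zero) + ∑[ i < m ] 𝟙 (isOcc R π zero (suc i))
        ≡⟨ cong₂ _+_ (𝟙-false (no-occurrence-at R π zero)) (sum-cong-≗ (cong 𝟙 ∘ isOcc-insert-min)) ⟩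
      records (side a) (side b) σ ∎
      where
      open ≡-Reasoning
      not-first : ∀ j i₂ → ¬ T (isOcc R π (suc j) i₂)
      not-first j i₂ t with () ← proj₁ (occurrence-bottom-left (insert-IsPerm zero zero σ-perm) row column
                                         (occurrence R π (suc j) i₂ t))

    occ-insert-other : IsPerm σ → ∀ u → occ R (insert zero (suc u) σ) ≡ 0
    occ-insert-other σ-perm u = trans (occ≡∑∑ R π′) (∑-zero λ i₁ → ∑-zero λ i₂ → 𝟙-false (impossible i₁ i₂))
      where
      π′ = insert zero (suc u) σ
      impossible : ∀ i₁ i₂ → ¬ T (isOcc R π′ i₁ i₂)
      impossible i₁ i₂ t
        with refl , min ← occurrence-bottom-left (insert-IsPerm zero (suc u) σ-perm) row column (occurrence R π′ i₁ i₂ t)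
        with () ← trans (sym (lookup-insert zero (suc u) σ)) min

  s≡sFormula : ∀ n k → s R n k ≡ sFormula n k
  s≡sFormula zero    = s-zero R
  s≡sFormula (suc m) = s-by-insertion R {m} zero zero (side a) (side b)
                         (λ {σ} → occ-insert-min σ) (λ {σ} → occ-insert-other σ)

_≟-box_ : DecidableEquality Box
_≟-box_ = ≡-dec Fin._≟_ Fin._≟_

shape? : ∀ o E R → Dec (Shape o E R)
shape? o E R = map′ (λ (r , c , e , a) → shape r c e a) (λ sh → row sh , column sh , E∈R sh , others sh)
  (     Fin.all? (λ c → (c , o) ∈? R)
  ×-dec Fin.all? (λ c → (o , c) ∈? R)
  ×-dec E ∈? R
  ×-dec All.all? (λ box → proj₂ box Fin.≟ o ⊎-dec proj₁ box Fin.≟ o ⊎-dec box ≟-box E) R)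
  where
  open Shape
  open import Data.List.Membership.DecPropositional _≟-box_ using (_∈?_)

s-patterns≡sFormula : ∀ i n k → s (patterns i) n k ≡ sFormula n k
s-patterns≡sFormula 0F = MaxFamily.s≡sFormula 0F 1F (from-yes (shape? f2 (f0 , f1) R₁))
s-patterns≡sFormula 1F = MaxFamily.s≡sFormula 1F 0F (from-yes (shape? f2 (f1 , f0) R₂))
s-patterns≡sFormula 2F = MinFamily.s≡sFormula 0F 1F (from-yes (shape? f0 (f1 , f2) R₃))
s-patterns≡sFormula 3F = MinFamily.s≡sFormula 1F 0F (from-yes (shape? f0 (f2 , f1) R₄))
s-patterns≡sFormula 4F = MaxFamily.s≡sFormula 1F 1F (from-yes (shape? f2 (f1 , f1) R₅))
s-patterns≡sFormula 5F = MinFamily.s≡sFormula 0F 0F (from-yes (shape? f0 (f1 , f1) R₆))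
s-patterns≡sFormula 6F = MaxFamily.s≡sFormula 0F 0F (from-yes (shape? f2 (f0 , f0) R₇))
s-patterns≡sFormula 7F = MinFamily.s≡sFormula 1F 1F (from-yes (shape? f0 (f2 , f2) R₈))

-- Generating functions

≡ᵇ-sym : ∀ m n → (m ≡ᵇ n) ≡ (n ≡ᵇ m)
≡ᵇ-sym zero    zero    = refl
≡ᵇ-sym zero    (suc n) = refl
≡ᵇ-sym (suc m) zero    = refl
≡ᵇ-sym (suc m) (suc n) = ≡ᵇ-sym m n

mono≡𝟙 : ∀ m k → mono m k ≡ ℤ.+ 𝟙 (m ≡ᵇ k)
mono≡𝟙 m k rewrite ≡ᵇ-sym m k with k ≡ᵇ m
... | true  = refl
... | false = refl

Fgf-coefficient : ∀ R n k → Fgf R n k ≡ ℤ.+ s R n k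
Fgf-coefficient R n k =
  trans (foldr-mono (occ R) (perms n)) (cong ℤ.+_ (sym (length-filterᵇ (λ w → occ R w ≡ᵇ k) (perms n))))
  where
  foldr-mono : ∀ (h : A → ℕ) xs → foldr (λ w acc → mono (h w) ⊕₁ acc) 0₁ xs k ≡ ℤ.+ sum (map (λ w → 𝟙 (h w ≡ᵇ k)) xs)
  foldr-mono h []       = refl
  foldr-mono h (x ∷ xs) =
    trans (cong₂ ℤ._+_ (mono≡𝟙 (h x) k) (foldr-mono h xs)) (sym (ℤₚ.pos-+ (𝟙 (h x ≡ᵇ k)) _))

sumTo-head : ∀ n (f : ℕ → ℤ) → (∀ i → f (suc i) ≡ ℤ.+ 0) → sumTo n f ≡ f 0
sumTo-head zero    f vanish = refl
sumTo-head (suc n) f vanish = trans (cong₂ ℤ._+_ (sumTo-head n f vanish) (vanish n)) (ℤₚ.+-identityʳ (f 0))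

sumTo-head-two : ∀ n (f : ℕ → ℤ) → (∀ i → f (2 + i) ≡ ℤ.+ 0) → sumTo (suc n) f ≡ f 0 ℤ.+ f 1
sumTo-head-two zero    f vanish = refl
sumTo-head-two (suc n) f vanish = trans (cong₂ ℤ._+_ (sumTo-head-two n f vanish) (vanish n)) (ℤₚ.+-identityʳ _)

sumTo-last : ∀ n (f : ℕ → ℤ) → (∀ i → i < n → f i ≡ ℤ.+ 0) → sumTo n f ≡ f n
sumTo-last zero    f vanish = refl
sumTo-last (suc n) f vanish =
  trans (cong (ℤ._+ f (suc n)) (trans (sumTo-last n f (λ i i<n → vanish i (ℕ.m<n⇒m<1+n i<n))) (vanish n ℕ.≤-refl)))
        (ℤₚ.+-identityˡ (f (suc n)))

0⊛₁ : ∀ g k → (0₁ ⊛₁ g) k ≡ ℤ.+ 0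
0⊛₁ g k = sumTo-head k (λ i → 0₁ i ℤ.* g (k ∸ i)) (λ i → refl)

1⊛₁ : ∀ g k → (1₁ ⊛₁ g) k ≡ g k
1⊛₁ g k = trans (sumTo-head k (λ i → 1₁ i ℤ.* g (k ∸ i)) (λ i → refl)) (ℤₚ.*-identityˡ (g k))

∸-≥2 : ∀ {i k} → i < k → ∃ λ d → suc k ∸ i ≡ 2 + d
∸-≥2 {zero}  {suc k} _         = k , refl
∸-≥2 {suc i} {suc k} (s≤s i<k) = ∸-≥2 i<k

⊛₁-degree-one : ∀ (f c : Ser1) → (∀ d → c (2 + d) ≡ ℤ.+ 0) → ∀ k →
            (f ⊛₁ c) (suc k) ≡ f k ℤ.* c 1 ℤ.+ f (suc k) ℤ.* c 0
⊛₁-degree-one f c vanish k = cong₂ ℤ._+_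
  (trans (sumTo-last k (λ i → f i ℤ.* c (suc k ∸ i)) low) (cong (λ j → f k ℤ.* c j) (ℕ.m+n∸n≡m 1 k)))
  (cong (λ j → f (suc k) ℤ.* c j) (ℕ.n∸n≡0 k))
  where
  low : ∀ i → i < k → f i ℤ.* c (suc k ∸ i) ≡ ℤ.+ 0
  low i i<k with d , eq ← ∸-≥2 i<k rewrite eq | vanish d = ℤₚ.*-zeroʳ (f i)

stirling-suc-zero : ∀ m → stirling (suc m) 0 ≡ 0
stirling-suc-zero zero    = refl
stirling-suc-zero (suc m) = trans (cong (suc m *_) (stirling-suc-zero m)) (ℕ.*-zeroʳ (suc m))

rising≡stirling : ∀ m k → rising m k ≡ ℤ.+ stirling m k
rising≡stirling zero    zero    = refl
rising≡stirling zero    (suc k) = refl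
rising≡stirling (suc m) zero    = begin
  rising m 0 ℤ.* ℤ.+ m             ≡⟨ cong (ℤ._* ℤ.+ m) (rising≡stirling m 0) ⟩
  ℤ.+ stirling m 0 ℤ.* ℤ.+ m       ≡⟨ ℤₚ.pos-* (stirling m 0) m ⟨
  ℤ.+ (stirling m 0 * m)           ≡⟨ cong ℤ.+_ (ℕ.*-comm (stirling m 0) m) ⟩
  ℤ.+ stirling (suc m) 0           ∎
  where open ≡-Reasoning
rising≡stirling (suc m) (suc k) = begin
  rising (suc m) (suc k)
    ≡⟨ ⊛₁-degree-one (rising m) (var₁ ⊕₁ const₁ (ℤ.+ m)) (λ d → refl) k ⟩
  rising m k ℤ.* ℤ.+ 1 ℤ.+ rising m (suc k) ℤ.* ℤ.+ m
    ≡⟨ cong₂ ℤ._+_ (trans (ℤₚ.*-identityʳ (rising m k)) (rising≡stirling m k))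
                   (cong (ℤ._* ℤ.+ m) (rising≡stirling m (suc k))) ⟩
  ℤ.+ stirling m k ℤ.+ ℤ.+ stirling m (suc k) ℤ.* ℤ.+ m
    ≡⟨ cong (λ x → ℤ.+ stirling m k ℤ.+ x) (ℤₚ.pos-* (stirling m (suc k)) m) ⟨
  ℤ.+ stirling m k ℤ.+ ℤ.+ (stirling m (suc k) * m)
    ≡⟨ ℤₚ.pos-+ (stirling m k) (stirling m (suc k) * m) ⟨
  ℤ.+ (stirling m k + stirling m (suc k) * m)
    ≡⟨ cong ℤ.+_ (trans (ℕ.+-comm (stirling m k) _) (cong (_+ stirling m k) (ℕ.*-comm (stirling m (suc k)) m))) ⟩
  ℤ.+ stirling (suc m) (suc k) ∎
  where open ≡-Reasoning

one-minus-x-times-Fact : ∀ m → ((1₁ ⊖₁ var₁) ⊛₁ Fact) (suc m) ≡ ℤ.+ (m * m !)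
one-minus-x-times-Fact m = begin
  ((1₁ ⊖₁ var₁) ⊛₁ Fact) (suc m)
    ≡⟨ sumTo-head-two m (λ i → (1₁ ⊖₁ var₁) i ℤ.* Fact (suc m ∸ i)) (λ i → refl) ⟩
  ℤ.+ 1 ℤ.* ℤ.+ (suc m !) ℤ.+ ℤ.-1ℤ ℤ.* ℤ.+ (m !)
    ≡⟨ cong₂ ℤ._+_ (ℤₚ.*-identityˡ (ℤ.+ (suc m !))) (ℤₚ.-1*i≡-i (ℤ.+ (m !))) ⟩
  ℤ.+ (m ! + m * m !) ℤ.- ℤ.+ (m !)
    ≡⟨ ℤₚ.m-n≡m⊖n (m ! + m * m !) (m !) ⟩
  (m ! + m * m !) ℤ.⊖ m !
    ≡⟨ ℤₚ.⊖-≥ (ℕ.m≤m+n (m !) (m * m !)) ⟩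
  ℤ.+ (m ! + m * m ! ∸ m !)
    ≡⟨ cong ℤ.+_ (ℕ.m+n∸m≡n (m !) (m * m !)) ⟩
  ℤ.+ (m * m !) ∎
  where open ≡-Reasoning

A-closed-form : ∀ n → (((1₁ ⊖₁ var₁) ⊛₁ Fact) ⊕₁ var₁) n ≡ ℤ.+ sFormula n 0
A-closed-form zero    = refl
A-closed-form (suc m) = begin
  ((1₁ ⊖₁ var₁) ⊛₁ Fact) (suc m) ℤ.+ var₁ (suc m)
    ≡⟨ cong₂ ℤ._+_ (one-minus-x-times-Fact m) (var₁-suc m) ⟩
  ℤ.+ (m * m !) ℤ.+ ℤ.+ stirling m 0
    ≡⟨ ℤₚ.pos-+ (m * m !) (stirling m 0) ⟨
  ℤ.+ (m * m ! + stirling m 0)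
    ≡⟨ cong ℤ.+_ (trans (ℕ.+-comm (m * m !) _) (cong (λ x → stirling m 0 + m * x) (sym (ℕ.*-identityʳ (m !))))) ⟩
  ℤ.+ sFormula (suc m) 0 ∎
  where
  open ≡-Reasoning
  var₁-suc : ∀ m → var₁ (suc m) ≡ ℤ.+ stirling m 0
  var₁-suc zero    = refl
  var₁-suc (suc m) = cong ℤ.+_ (sym (stirling-suc-zero m))

X₂⊛₂-zero : ∀ G k → (X₂ ⊛₂ G) 0 k ≡ ℤ.+ 0
X₂⊛₂-zero G k = 0⊛₁ (G 0) k

X₂⊛₂-suc : ∀ G m k → (X₂ ⊛₂ G) (suc m) k ≡ G m k
X₂⊛₂-suc G m k = trans (sumTo-head-two m (λ i → (X₂ i ⊛₁ G (suc m ∸ i)) k) (λ i → 0⊛₁ (G (m ∸ suc i)) k))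
  (trans (cong₂ ℤ._+_ (0⊛₁ (G (suc m)) k) (1⊛₁ (G m) k)) (ℤₚ.+-identityˡ (G m k)))

F-closed-form : ∀ n k → (lift (((1₁ ⊖₁ var₁) ⊛₁ Fact) ⊕₁ var₁) ⊕₂ (X₂ ⊛₂ sumFrom1 rising)) n k ≡ ℤ.+ sFormula n k
F-closed-form zero    zero    = cong (λ x → ℤ.+ 1 ℤ.+ x) (X₂⊛₂-zero (sumFrom1 rising) 0)
F-closed-form zero    (suc k) = trans (ℤₚ.+-identityˡ _) (X₂⊛₂-zero (sumFrom1 rising) (suc k))
F-closed-form (suc m) zero    = trans (cong₂ ℤ._+_ (A-closed-form (suc m)) (trans (X₂⊛₂-suc (sumFrom1 rising) m 0) (no-constant m)))
                                      (ℤₚ.+-identityʳ _)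
  where
  no-constant : ∀ m → sumFrom1 rising m 0 ≡ ℤ.+ 0
  no-constant zero    = refl
  no-constant (suc m) = trans (rising≡stirling (suc m) 0) (cong ℤ.+_ (stirling-suc-zero m))
F-closed-form (suc m) (suc k) = trans (ℤₚ.+-identityˡ _) (trans (X₂⊛₂-suc (sumFrom1 rising) m (suc k)) (coefficient m))
  where
  coefficient : ∀ m → sumFrom1 rising m (suc k) ≡ ℤ.+ sFormula (suc m) (suc k)
  coefficient zero    = refl
  coefficient (suc m) = trans (rising≡stirling (suc m) (suc k)) (cong ℤ.+_ (sym (begin
    stirling (suc m) (suc k) + suc m * (suc m ! * 0) ≡⟨ cong (λ x → stirling (suc m) (suc k) + suc m * x) (ℕ.*-zeroʳ (suc m !)) ⟩
    stirling (suc m) (suc k) + suc m * 0             ≡⟨ cong (stirling (suc m) (suc k) +_) (ℕ.*-zeroʳ (suc m)) ⟩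
    stirling (suc m) (suc k) + 0                     ≡⟨ ℕ.+-identityʳ _ ⟩
    stirling (suc m) (suc k)                         ∎)))
    where open ≡-Reasoning

theorem3p15 : ((i j : Fin 8) → Equidistributed (patterns i) (patterns j))
              × ((i : Fin 8) →
                   (Agf (patterns i) ≈₁ (((1₁ ⊖₁ var₁) ⊛₁ Fact) ⊕₁ var₁))
                 × (Fgf (patterns i) ≈₂ (lift (((1₁ ⊖₁ var₁) ⊛₁ Fact) ⊕₁ var₁) ⊕₂ (X₂ ⊛₂ sumFrom1 rising))))
theorem3p15 =
    (λ i j n k → trans (s-patterns≡sFormula i n k) (sym (s-patterns≡sFormula j n k)))
  , λ i → (λ n → trans (cong ℤ.+_ (s-patterns≡sFormula i n 0)) (sym (A-closed-form n)))
        , (λ n k → trans (Fgf-coefficient (patterns i) n k)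
                   (trans (cong ℤ.+_ (s-patterns≡sFormula i n k)) (sym (F-closed-form n k))))
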